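{- Let $k\ge 1$. The block matrix of a binary $k$-noncrossing diagram is a $k$-noncrossing matrix.
   Context: A diagram of length $n$ is a simple graph on sites $\{1,\dots,n\}$ whose edges (arcs) are pairs $(s_1,s_2)$ with $s_1<s_2$ and $1<s_2-s_1<n-1$, supported by $s_1,s_2$. A diagram is binary if it has at least one arc and each site supports at most one arc. A site is free if it supports no arc. Arcs $(s_1,s_2),(s_1',s_2')$ cross if $s_1<s_1'<s_2<s_2'$ or $s_1'<s_1<s_2'<s_2$; a diagram is $k$-noncrossing if it has no $k+1$ pairwise crossing arcs. If $u_1<\dots<u_f$ are the free sites, $u_0=0$, $u_{f+1}=n+1$, the $i$-th block $B_i$ is the set of sites $s$ with $u_{i-1}<s<u_i$. The block matrix $\mathbf B(S)=(b_{i,j})$ is the symmetric $(f+1)\times(f+1)$ matrix where, for $i\ne j$, $b_{i,j}$ is the number of arcs with one supporting site in $B_i$ and the other in $B_j$, and $b_{i,i}$ is the number of arcs with both supporting sites in $B_i$. In a matrix, entries $x_{i,j}$ and $x_{p,q}$ cross if $i,j,p,q$ are distinct and $\min\{i,j\}<\min\{p,q\}<\max\{i,j\}<\max\{p,q\}$ or $\min\{p,q\}<\min\{i,j\}<\max\{p,q\}<\max\{i,j\}$; a matrix is $k$-noncrossing if it has no $k+1$ pairwise crossing nonzero entries. -}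

module Defs where

open import Data.Nat using (ℕ; zero; suc; _+_; _∸_; _≤_; _<_; _<ᵇ_; _≡ᵇ_; NonZero)
open import Data.Nat.Base using (_⊓_; _⊔_)
open import Data.Bool using (Bool; true; false; not; _∧_; _∨_)
open import Data.List using (List; []; _∷_; length; filter; upTo; map)
open import Data.List.Membership.Propositional using (_∈_)
open import Data.List.Relation.Unary.All using (All)
open import Data.List.Relation.Unary.Unique.Propositional using (Unique)
open import Data.List.Relation.Unary.Any using (any?)
open import Data.Product using (_×_; _,_; proj₁; proj₂; Σ; ∃)
open import Data.Sum using (_⊎_)
open import Data.Fin using (Fin)
open import Relation.Binary.PropositionalEquality using (_≡_; _≢_)
open import Relation.Nullary using (¬_)
open import Relation.Nullary.Decidable using (does)

Arc : Set
Arc = ℕ × ℕ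

Diagram : Set
Diagram = List Arc

ValidArc : ℕ → Arc → Set
ValidArc n (s₁ , s₂) =
  1 ≤ s₁ × s₁ < s₂ × s₂ ≤ n × 1 < s₂ ∸ s₁ × s₂ ∸ s₁ < n ∸ 1

IsDiagram : ℕ → Diagram → Set
IsDiagram n D = All (ValidArc n) D × Unique D

Supports : ℕ → Arc → Set
Supports s (s₁ , s₂) = s ≡ s₁ ⊎ s ≡ s₂

IsBinary : Diagram → Set
IsBinary D = (D ≢ []) ×
  (∀ s a b → a ∈ D → b ∈ D → Supports s a → Supports s b → a ≡ b)

ArcsCross : Arc → Arc → Set
ArcsCross (s₁ , s₂) (t₁ , t₂) =
  (s₁ < t₁ × t₁ < s₂ × s₂ < t₂) ⊎ (t₁ < s₁ × s₁ < t₂ × t₂ < s₂)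

KNoncrossingDiagram : ℕ → Diagram → Set
KNoncrossingDiagram k D =
  ¬ (Σ (Fin (suc k) → Arc) λ a →
       (∀ t → a t ∈ D) × (∀ t u → t ≢ u → ArcsCross (a t) (a u)))

supportsᵇ : ℕ → Arc → Bool
supportsᵇ s (s₁ , s₂) = (s ≡ᵇ s₁) ∨ (s ≡ᵇ s₂)

anyᵇ : {A : Set} → (A → Bool) → List A → Bool
anyᵇ p [] = false
anyᵇ p (x ∷ xs) = p x ∨ anyᵇ p xs

count : {A : Set} → (A → Bool) → List A → ℕ
count p [] = 0
count p (x ∷ xs) with p x
... | true = suc (count p xs)
... | false = count p xs

isFree : Diagram → ℕ → Bool
isFree D s = not (anyᵇ (supportsᵇ s) D)

sites : ℕ → List ℕ
sites n = map suc (upTo n)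

freeSites : ℕ → Diagram → List ℕ
freeSites n D = filterᵇ (sites n)
  where
  filterᵇ : List ℕ → List ℕ
  filterᵇ [] = []
  filterᵇ (x ∷ xs) with isFree D x
  ... | true = x ∷ filterᵇ xs
  ... | false = filterᵇ xs

numFree : ℕ → Diagram → ℕ
numFree n D = length (freeSites n D)

-- (1-based) index of the block containing site s: 1 + #{free u : u < s},
-- i.e. s ∈ B_i with u_{i-1} < s < u_i.
blockOf : ℕ → Diagram → ℕ → ℕ
blockOf n D s = suc (count (λ u → u <ᵇ s) (freeSites n D))

-- Block matrix, indexed 1-based by i, j ∈ {1, …, f+1}.
-- b i j counts arcs with one supporting site in B_i and the other in B_j
-- (for i = j: both in B_i).
blockMatrix : ℕ → Diagram → ℕ → ℕ → ℕ
blockMatrix n D i j = count p D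
  where
  p : Arc → Bool
  p (s₁ , s₂) = ((blockOf n D s₁ ≡ᵇ i) ∧ (blockOf n D s₂ ≡ᵇ j))
              ∨ ((blockOf n D s₁ ≡ᵇ j) ∧ (blockOf n D s₂ ≡ᵇ i))

Pos : Set
Pos = ℕ × ℕ

EntriesCross : Pos → Pos → Set
EntriesCross (i , j) (p , q) =
  (i ≢ j × i ≢ p × i ≢ q × j ≢ p × j ≢ q × p ≢ q) ×
  ((i ⊓ j < p ⊓ q × p ⊓ q < i ⊔ j × i ⊔ j < p ⊔ q) ⊎
   (p ⊓ q < i ⊓ j × i ⊓ j < p ⊔ q × p ⊔ q < i ⊔ j))

-- An m × m matrix (1-based indices 1..m) given by its entry function X.
InRange : ℕ → Pos → Set
InRange m (i , j) = 1 ≤ i × i ≤ m × 1 ≤ j × j ≤ m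

KNoncrossingMatrix : ℕ → (m : ℕ) → (ℕ → ℕ → ℕ) → Set
KNoncrossingMatrix k m X =
  ¬ (Σ (Fin (suc k) → Pos) λ e →
       (∀ t → InRange m (e t)) ×
       (∀ t → X (proj₁ (e t)) (proj₂ (e t)) ≢ 0) ×
       (∀ t u → t ≢ u → EntriesCross (e t) (e u)))

-- A nonzero entry (i , j) of the block matrix is witnessed by an arc whose
-- endpoints lie in the blocks i ⊓ j and i ⊔ j. Since the block index of a
-- site is monotone in the site, a strict inequality between block indices
-- forces the same strict inequality between the sites. Hence k + 1 pairwise
-- crossing nonzero entries yield k + 1 pairwise crossing arcs of the diagram.
module Submission where

open import Defs
open import Data.Nat using (ℕ; suc; _≤_; _<_; _≡ᵇ_; z≤n; s≤s; _⊓_; _⊔_)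
open import Data.Nat.Properties
open import Data.Bool using (Bool; true; false; T; _∧_; _∨_)
open import Data.Bool.Properties using (T-∧; T-∨)
open import Data.Empty using (⊥-elim)
open import Data.List using (List; []; _∷_)
open import Data.List.Membership.Propositional using (_∈_)
open import Data.List.Relation.Unary.Any using (here; there)
open import Data.List.Relation.Unary.All using (All; lookup)
open import Data.Product as Product using (_×_; _,_; proj₁; proj₂; ∃)
open import Data.Product.Properties using (×-≡,≡→≡)
open import Data.Sum as Sum using (_⊎_; inj₁; inj₂)
open import Function.Bundles using (Equivalence)
open import Relation.Binary.PropositionalEquality
open import Relation.Nullary using (yes; no)

count≢0⇒∃ : {A : Set} (p : A → Bool) (xs : List A) → count p xs ≢ 0 →
  ∃ λ x → x ∈ xs × T (p x)
count≢0⇒∃ p [] count≢0 = ⊥-elim (count≢0 refl)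
count≢0⇒∃ p (x ∷ xs) count≢0 with p x in px
... | true = x , here refl , subst T (sym px) _
... | false with count≢0⇒∃ p xs count≢0
...   | y , y∈xs , py = y , there y∈xs , py

count-mono : {A : Set} (p q : A → Bool) → (∀ x → T (p x) → T (q x)) →
  (xs : List A) → count p xs ≤ count q xs
count-mono p q p⇒q [] = z≤n
count-mono p q p⇒q (x ∷ xs) with p x | q x | p⇒q x
... | true  | true  | _   = s≤s (count-mono p q p⇒q xs)
... | true  | false | p⇒q = ⊥-elim (p⇒q _)
... | false | true  | _   = m≤n⇒m≤1+n (count-mono p q p⇒q xs)
... | false | false | _   = count-mono p q p⇒q xs

monotone⇒reflects-< : (f : ℕ → ℕ) → (∀ {x y} → x ≤ y → f x ≤ f y) →
  ∀ {x y} → f x < f y → x < y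
monotone⇒reflects-< f mono {x} {y} fx<fy with x <? y
... | yes x<y = x<y
... | no x≮y = ⊥-elim (<⇒≱ fx<fy (mono (≮⇒≥ x≮y)))

mapArc : (ℕ → ℕ) → Arc → Arc
mapArc f (s₁ , s₂) = f s₁ , f s₂

ArcsCross-reflect : (f : ℕ → ℕ) → (∀ {x y} → x ≤ y → f x ≤ f y) →
  ∀ a b → ArcsCross (mapArc f a) (mapArc f b) → ArcsCross a b
ArcsCross-reflect f mono _ _ = Sum.map reflect-chain reflect-chain
  where
  reflect = monotone⇒reflects-< f mono
  reflect-chain : ∀ {x y z w} → f x < f y × f y < f z × f z < f w → x < y × y < z × z < w
  reflect-chain = Product.map reflect (Product.map reflect reflect)

blockOf-mono : ∀ n D {s s′} → s ≤ s′ → blockOf n D s ≤ blockOf n D s′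
blockOf-mono n D s≤s′ = s≤s (count-mono _ _
  (λ u u<s → <⇒<ᵇ (<-≤-trans (<ᵇ⇒< u _ u<s) s≤s′)) (freeSites n D))

sortedPos : Pos → Arc
sortedPos (i , j) = i ⊓ j , i ⊔ j

sortedPos-of-ordered : ∀ {x y i j} → x ≤ y →
  (x ≡ i × y ≡ j) ⊎ (x ≡ j × y ≡ i) → sortedPos (i , j) ≡ (x , y)
sortedPos-of-ordered x≤y (inj₁ (refl , refl)) =
  ×-≡,≡→≡ (m≤n⇒m⊓n≡m x≤y , m≤n⇒m⊔n≡n x≤y)
sortedPos-of-ordered x≤y (inj₂ (refl , refl)) =
  ×-≡,≡→≡ (m≥n⇒m⊓n≡n x≤y , m≥n⇒m⊔n≡m x≤y)

T-unordered-pair : ∀ x y i j →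
  T (((x ≡ᵇ i) ∧ (y ≡ᵇ j)) ∨ ((x ≡ᵇ j) ∧ (y ≡ᵇ i))) →
  (x ≡ i × y ≡ j) ⊎ (x ≡ j × y ≡ i)
T-unordered-pair x y i j h = Sum.map (both i j) (both j i) (Equivalence.to T-∨ h)
  where
  both : ∀ i j → T ((x ≡ᵇ i) ∧ (y ≡ᵇ j)) → x ≡ i × y ≡ j
  both i j h = Product.map (≡ᵇ⇒≡ x i) (≡ᵇ⇒≡ y j) (Equivalence.to T-∧ h)

blockMatrix≢0⇒arc : ∀ n D → All (ValidArc n) D → ∀ i j → blockMatrix n D i j ≢ 0 →
  ∃ λ a → a ∈ D × mapArc (blockOf n D) a ≡ sortedPos (i , j)
blockMatrix≢0⇒arc n D valid i j b≢0 with count≢0⇒∃ _ D b≢0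
... | (s₁ , s₂) , a∈D , pa with lookup valid a∈D
...   | _ , s₁<s₂ , _ = (s₁ , s₂) , a∈D , sym (sortedPos-of-ordered
          (blockOf-mono n D (<⇒≤ s₁<s₂))
          (T-unordered-pair (blockOf n D s₁) (blockOf n D s₂) i j pa))

lemma3p2 : (k : ℕ) → 1 ≤ k → (n : ℕ) → (D : Diagram) →
    IsDiagram n D → IsBinary D → KNoncrossingDiagram k D →
    KNoncrossingMatrix k (suc (numFree n D)) (blockMatrix n D)
lemma3p2 k _ n D (valid , _) _ noncrossing (e , _ , e≢0 , e-cross) =
  noncrossing ((λ t → proj₁ (witness t)) , (λ t → proj₁ (proj₂ (witness t))) , arcs-cross)
  where
  witness : ∀ t → ∃ λ a → a ∈ D × mapArc (blockOf n D) a ≡ sortedPos (e t)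
  witness t = blockMatrix≢0⇒arc n D valid _ _ (e≢0 t)

  arcs-cross : ∀ t u → t ≢ u → ArcsCross (proj₁ (witness t)) (proj₁ (witness u))
  -- The order part of EntriesCross is literally ArcsCross of the sorted positions.
  arcs-cross t u t≢u = ArcsCross-reflect (blockOf n D) (blockOf-mono n D) _ _
    (subst₂ ArcsCross (sym (proj₂ (proj₂ (witness t)))) (sym (proj₂ (proj₂ (witness u))))
      (proj₂ (e-cross t u t≢u)))
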